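{- Let $p$ be an odd prime such that $2$ is a primitive root modulo $p$. Let $\theta\in\overline{\mathbb{F}}_2$ with $\theta^p=1$ and $\theta\ne1$, and let $G(X)\in\mathbb{F}_2[X]$ with $1\le\deg G(X)<p$. Then $G(\theta)=1$ if and only if $G(X)=X+X^2+\dots+X^{p-1}$.
   Context: $\overline{\mathbb{F}}_2$ denotes an algebraic closure of $\mathbb{F}_2$. -}

module Defs where

open import Level using (Level; _⊔_; suc)
open import Algebra.Bundles using (CommutativeRing)
open import Data.Bool using (Bool; true; false; if_then_else_; not; _∧_)
open import Data.List using (List; []; _∷_)
open import Data.Nat as ℕ using (ℕ; zero; _∸_; _≤_; _<_; _%_)
import Data.Nat.Properties as ℕP
open import Data.Nat.Primality using (Prime)
open import Data.Product using (Σ; _×_)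
open import Relation.Nullary using (¬_)
open import Relation.Binary.PropositionalEquality using (_≡_)

record Field (c ℓ : Level) : Set (Level.suc (c ⊔ ℓ)) where
  field
    commRing : CommutativeRing c ℓ
  open CommutativeRing commRing public
  field
    1≉0     : ¬ (1# ≈ 0#)
    inverse : ∀ x → ¬ (x ≈ 0#) → Σ Carrier (λ y → x * y ≈ 1#)

HasChar2 : ∀ {c ℓ} → Field c ℓ → Set ℓ
HasChar2 K = 1# + 1# ≈ 0#
  where open Field K

pow : ∀ {c ℓ} (K : Field c ℓ) → Field.Carrier K → ℕ → Field.Carrier K
pow K x zero = Field.1# K
pow K x (ℕ.suc n) = Field._*_ K x (pow K x n)

-- Polynomials over F₂: coefficient lists, lowest degree first (true = 1, false = 0).
Poly₂ : Set
Poly₂ = List Bool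

coeff : Poly₂ → ℕ → Bool
coeff []       _           = false
coeff (b ∷ bs) zero        = b
coeff (b ∷ bs) (ℕ.suc i)   = coeff bs i

isZero : Poly₂ → Bool
isZero []       = true
isZero (b ∷ bs) = not b ∧ isZero bs

-- Degree (with the convention deg 0 = 0; irrelevant here since we require deg ≥ 1).
deg : Poly₂ → ℕ
deg []       = 0
deg (b ∷ bs) = if isZero bs then 0 else ℕ.suc (deg bs)

eval : ∀ {c ℓ} (K : Field c ℓ) → Poly₂ → Field.Carrier K → Field.Carrier K
eval K []       θ = Field.0# K
eval K (b ∷ bs) θ = Field._+_ K (if b then Field.1# K else Field.0# K)
                                (Field._*_ K θ (eval K bs θ))

_≐_ : Poly₂ → Poly₂ → Set
F ≐ G = ∀ i → coeff F i ≡ coeff G i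

sumX : ℕ → Poly₂
sumX zero = []
sumX (ℕ.suc n) = false ∷ go n
  where
  go : ℕ → Poly₂
  go zero = []
  go (ℕ.suc k) = true ∷ go k

-- g is a primitive root modulo n: the multiplicative order of g mod n is n - 1
-- (here used for n prime, where φ(n) = n - 1).
IsPrimitiveRootMod : ℕ → (n : ℕ) → .{{_ : ℕ.NonZero n}} → Set
IsPrimitiveRootMod g n =
  ((g ℕ.^ (n ∸ 1)) % n ≡ 1 % n) ×
  (∀ k → 1 ≤ k → k < n ∸ 1 → ¬ ((g ℕ.^ k) % n ≡ 1 % n))

-- If G(θ) = 1 then H = G + 1 vanishes at θ, hence by the Frobenius map at every θ^(2^k), and
-- since 2 generates (ℤ/p)ˣ at every θ^j with 0 < j < p. Discrete Fourier inversion over the p-th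
-- roots of unity (where p · 1 = 1, as p is odd and the characteristic is 2) then shows that every
-- coefficient of H below X^p equals H(1): H = 0 or H = 1 + X + ⋯ + X^(p-1), and deg G ≥ 1 excludes
-- the former. Conversely (θ - 1)(1 + θ + ⋯ + θ^(p-1)) = θ^p - 1 = 0 with θ ≠ 1.
module Submission where

open import Defs
open import Algebra.Bundles using (Semiring)
import Algebra.Properties.CommutativeSemigroup
open import Data.Bool using (Bool; true; false; if_then_else_; not)
open import Data.Fin as Fin using (Fin; toℕ; fromℕ<; punchOut)
import Data.Fin.Properties as Finₚ
open import Data.List using ([]; _∷_)
open import Data.Nat as ℕ using (ℕ; zero; suc; _≤_; _<_; s≤s; z≤n; NonZero; >-nonZero; _<?_)
import Data.Nat.Properties as ℕₚ
open import Data.Nat.Divisibility using (_∣_; divides; m%n≡0⇒n∣m; >⇒∤; ∣m+n∣m⇒∣n; ∣m∣n⇒∣m+n; ∣-refl)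
open import Data.Nat.Primality using (Prime; prime⇒irreducible; ¬prime[0]; ¬prime[1])
open import Data.Product using (_,_; proj₁; proj₂; ∃-syntax)
open import Data.Sum using (inj₁; inj₂)
open import Data.Vec.Functional using (Vector)
open import Function.Base using (_∘_)
open import Function.Bundles using (_⇔_; mk⇔)
open import Function.Definitions using (Injective)
open import Relation.Binary.Definitions using (tri<; tri≈; tri>)
open import Relation.Binary.PropositionalEquality as ≡ using (_≡_; _≢_; ≢-sym)
open import Relation.Nullary using (¬_; yes; no; contradiction)

module _ where

  open import Data.Nat using (_+_; _*_; _∸_; _^_)
  open import Data.Nat.DivMod using (_%_; %-distribˡ-*; m%n<n)
  open import Data.Nat.Properties
  open ≡ using (refl; sym; trans; cong; subst; module ≡-Reasoning)

  *-congʳ-mod : ∀ {n} .{{_ : NonZero n}} a b c → a % n ≡ b % n → (a * c) % n ≡ (b * c) % n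
  *-congʳ-mod {n} a b c a≡b = begin
    (a * c) % n               ≡⟨ %-distribˡ-* a c n ⟩
    (a % n * (c % n)) % n     ≡⟨ cong (λ r → (r * (c % n)) % n) a≡b ⟩
    (b % n * (c % n)) % n     ≡⟨ %-distribˡ-* b c n ⟨
    (b * c) % n               ∎
    where open ≡-Reasoning

  injective∧avoids⇒hits : ∀ {m} (f : Fin m → Fin (suc m)) → Injective _≡_ _≡_ f →
                          ∀ {a} → (∀ k → f k ≢ a) → ∀ b → b ≢ a → ∃[ k ] f k ≡ b
  injective∧avoids⇒hits {zero} f _ {Fin.zero} _ Fin.zero b≢a = contradiction refl b≢a
  injective∧avoids⇒hits {suc m} f f-inj {a} f≢a b b≢a with Finₚ.any? (λ k → f k Finₚ.≟ b)
  ... | yes hit  = hit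
  ... | no miss = contradiction (Finₚ.injective⇒≤ g-inj) 1+n≰n
    where
    b′ : Fin (suc m)
    b′ = punchOut (≢-sym b≢a)
    f′ : Fin (suc m) → Fin (suc m)
    f′ k = punchOut (≢-sym (f≢a k))
    b′≢f′ : ∀ k → b′ ≢ f′ k
    b′≢f′ k b′≡f′k = miss (k , sym (Finₚ.punchOut-injective (≢-sym b≢a) (≢-sym (f≢a k)) b′≡f′k))
    g : Fin (suc m) → Fin m
    g k = punchOut (b′≢f′ k)
    g-inj : Injective _≡_ _≡_ g
    g-inj {k} {l} gk≡gl = f-inj (Finₚ.punchOut-injective (≢-sym (f≢a k)) (≢-sym (f≢a l))
      (Finₚ.punchOut-injective (b′≢f′ k) (b′≢f′ l) gk≡gl))

  module PrimitiveRoot {g m : ℕ} (prim : IsPrimitiveRootMod g (suc (suc m))) where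

    private
      n : ℕ
      n = suc (suc m)

    powMod-complement : ∀ {a x} → a ≤ suc m → g ^ a % n ≡ x % n → (x * g ^ (suc m ∸ a)) % n ≡ 1
    powMod-complement {a} {x} a≤1+m gᵃ≡x = begin
      (x * g ^ c) % n        ≡⟨ *-congʳ-mod (g ^ a) x (g ^ c) gᵃ≡x ⟨
      (g ^ a * g ^ c) % n    ≡⟨ cong (_% n) (^-distribˡ-+-* g a c) ⟨
      g ^ (a + c) % n        ≡⟨ cong (λ e → g ^ e % n) (m+[n∸m]≡n a≤1+m) ⟩
      g ^ suc m % n          ≡⟨ proj₁ prim ⟩
      1                      ∎
      where
      open ≡-Reasoning
      c = suc m ∸ a

    powMod-<-distinct : ∀ {a b} → a < b → b < suc m → g ^ a % n ≢ g ^ b % n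
    powMod-<-distinct {a} {b} a<b b<m gᵃ≡gᵇ = proj₂ prim (a + c) 1≤a+c a+c<m (begin
      g ^ (a + c) % n       ≡⟨ cong (_% n) (^-distribˡ-+-* g a c) ⟩
      (g ^ a * g ^ c) % n   ≡⟨ powMod-complement {x = g ^ a} (<⇒≤ b<m) (sym gᵃ≡gᵇ) ⟩
      1                     ∎)
      where
      open ≡-Reasoning
      c = suc m ∸ b
      1≤a+c : 1 ≤ a + c
      1≤a+c = ≤-trans (m<n⇒0<n∸m b<m) (m≤n+m c a)
      a+c<m : a + c < suc m
      a+c<m = subst (a + c <_) (m+[n∸m]≡n (<⇒≤ b<m)) (+-monoˡ-< c a<b)

    powMod-injective : ∀ {a b} → a < suc m → b < suc m → g ^ a % n ≡ g ^ b % n → a ≡ b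
    powMod-injective {a} {b} a<m b<m gᵃ≡gᵇ with <-cmp a b
    ... | tri< a<b _ _ = contradiction gᵃ≡gᵇ (powMod-<-distinct a<b b<m)
    ... | tri≈ _ a≡b _ = a≡b
    ... | tri> _ _ b<a = contradiction (sym gᵃ≡gᵇ) (powMod-<-distinct b<a a<m)

    powMod-nonzero : ∀ {a} → a < suc m → g ^ a % n ≢ 0
    powMod-nonzero a<m gᵃ≡0 with () ← powMod-complement {x = 0} (<⇒≤ a<m) gᵃ≡0

    powModFin : Fin (suc m) → Fin n
    powModFin k = fromℕ< (m%n<n (g ^ toℕ k) n)

    toℕ-powModFin : ∀ k → toℕ (powModFin k) ≡ g ^ toℕ k % n
    toℕ-powModFin k = Finₚ.toℕ-fromℕ< (m%n<n (g ^ toℕ k) n)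

    powModFin-injective : Injective _≡_ _≡_ powModFin
    powModFin-injective {k} {l} eq = Finₚ.toℕ-injective (powMod-injective (Finₚ.toℕ<n k) (Finₚ.toℕ<n l)
      (trans (sym (toℕ-powModFin k)) (trans (cong toℕ eq) (toℕ-powModFin l))))

    powModFin≢0 : ∀ k → powModFin k ≢ Fin.zero
    powModFin≢0 k eq = powMod-nonzero (Finₚ.toℕ<n k) (trans (sym (toℕ-powModFin k)) (cong toℕ eq))

    powMod-surjective : ∀ j → 0 < j → j < n → ∃[ k ] g ^ k % n ≡ j
    powMod-surjective j 0<j j<n =
      let k , hit = injective∧avoids⇒hits powModFin powModFin-injective powModFin≢0 (fromℕ< j<n) j≢0
      in toℕ k , trans (sym (toℕ-powModFin k)) (trans (cong toℕ hit) (Finₚ.toℕ-fromℕ< j<n))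
      where
      j≢0 : fromℕ< j<n ≢ Fin.zero
      j≢0 eq = <⇒≢ 0<j (sym (trans (sym (Finₚ.toℕ-fromℕ< j<n)) (cong toℕ eq)))

  ∣+∸⇒≡ : ∀ {p i k} → i < p → k < p → p ∣ i + (p ∸ k) → i ≡ k
  ∣+∸⇒≡ {p} {i} {k} i<p k<p p∣i+[p∸k] with <-cmp i k
  ... | tri≈ _ i≡k _ = i≡k
  ... | tri< i<k _ _ = contradiction p∣i+[p∸k] (>⇒∤ {{>-nonZero 0<i+[p∸k]}} i+[p∸k]<p)
    where
    0<i+[p∸k] : 0 < i + (p ∸ k)
    0<i+[p∸k] = ≤-trans (m<n⇒0<n∸m k<p) (m≤n+m (p ∸ k) i)
    i+[p∸k]<p : i + (p ∸ k) < p
    i+[p∸k]<p = subst (i + (p ∸ k) <_) (m+[n∸m]≡n (<⇒≤ k<p)) (+-monoˡ-< (p ∸ k) i<k)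
  ... | tri> _ _ k<i = contradiction (∣m+n∣m⇒∣n p∣p+[i∸k] ∣-refl)
                                     (>⇒∤ {{>-nonZero (m<n⇒0<n∸m k<i)}} (≤-<-trans (m∸n≤m i k) i<p))
    where
    open ≡-Reasoning
    p∣p+[i∸k] : p ∣ p + (i ∸ k)
    p∣p+[i∸k] = subst (p ∣_) (begin
      i + (p ∸ k)  ≡⟨ +-∸-assoc i (<⇒≤ k<p) ⟨
      i + p ∸ k    ≡⟨ +-∸-comm p (<⇒≤ k<i) ⟩
      i ∸ k + p    ≡⟨ +-comm (i ∸ k) p ⟩
      p + (i ∸ k)  ∎) p∣i+[p∸k]


isZero⇒coeff≡false : ∀ G i → isZero G ≡ true → coeff G i ≡ false
isZero⇒coeff≡false []           i       _  = ≡.refl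
isZero⇒coeff≡false (false ∷ bs) zero    _  = ≡.refl
isZero⇒coeff≡false (false ∷ bs) (suc i) z  = isZero⇒coeff≡false bs i z
isZero⇒coeff≡false (true ∷ bs)  i       ()

coeff≡false⇒isZero : ∀ G → (∀ i → coeff G i ≡ false) → isZero G ≡ true
coeff≡false⇒isZero []       _ = ≡.refl
coeff≡false⇒isZero (b ∷ bs) z with ≡.refl ← z 0 = coeff≡false⇒isZero bs (z ∘ suc)

deg<⇒coeff≡false : ∀ G i → deg G < i → coeff G i ≡ false
deg<⇒coeff≡false []       i       _ = ≡.refl
deg<⇒coeff≡false (b ∷ bs) (suc i) d with isZero bs in z
... | true  = isZero⇒coeff≡false bs i z
... | false = deg<⇒coeff≡false bs i (ℕₚ.≤-pred d)

coeff-suc≡false⇒deg≡0 : ∀ G → (∀ i → coeff G (suc i) ≡ false) → deg G ≡ 0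
coeff-suc≡false⇒deg≡0 []       _ = ≡.refl
coeff-suc≡false⇒deg≡0 (b ∷ bs) z rewrite coeff≡false⇒isZero bs z = ≡.refl

coeff-sumX-< : ∀ n i → i < n → coeff (sumX (suc n)) (suc i) ≡ true
coeff-sumX-< (suc n) zero    _         = ≡.refl
coeff-sumX-< (suc n) (suc i) (s≤s i<n) = coeff-sumX-< n i i<n

coeff-sumX-≥ : ∀ n i → n ≤ i → coeff (sumX (suc n)) (suc i) ≡ false
coeff-sumX-≥ zero    i       _         = ≡.refl
coeff-sumX-≥ (suc n) (suc i) (s≤s n≤i) = coeff-sumX-≥ n i n≤i

flat⇒≐sumX : ∀ n G → 1 ≤ deg G → deg G ≤ n →
        (∀ i → i < n → coeff G (suc i) ≡ not (coeff G 0)) → G ≐ sumX (suc n)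
flat⇒≐sumX n G 1≤deg deg≤n flat with coeff G 0 in G₀
... | true  = contradiction (coeff-suc≡false⇒deg≡0 G beyond₀) (≢-sym (ℕₚ.<⇒≢ 1≤deg))
  where
  beyond₀ : ∀ i → coeff G (suc i) ≡ false
  beyond₀ i with i <? n
  ... | yes i<n = flat i i<n
  ... | no  i≮n = deg<⇒coeff≡false G (suc i) (s≤s (ℕₚ.≤-trans deg≤n (ℕₚ.≮⇒≥ i≮n)))
... | false = λ { zero → G₀ ; (suc i) → agree i }
  where
  agree : ∀ i → coeff G (suc i) ≡ coeff (sumX (suc n)) (suc i)
  agree i with i <? n
  ... | yes i<n = ≡.trans (flat i i<n) (≡.sym (coeff-sumX-< n i i<n))
  ... | no  i≮n = ≡.trans (deg<⇒coeff≡false G (suc i) (s≤s (ℕₚ.≤-trans deg≤n (ℕₚ.≮⇒≥ i≮n))))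
                        (≡.sym (coeff-sumX-≥ n i (ℕₚ.≮⇒≥ i≮n)))

plusOne : Poly₂ → Poly₂
plusOne []       = true ∷ []
plusOne (b ∷ bs) = not b ∷ bs

coeff-plusOne-zero : ∀ G → coeff (plusOne G) 0 ≡ not (coeff G 0)
coeff-plusOne-zero []      = ≡.refl
coeff-plusOne-zero (_ ∷ _) = ≡.refl

coeff-plusOne-suc : ∀ G i → coeff (plusOne G) (suc i) ≡ coeff G (suc i)
coeff-plusOne-suc []      _ = ≡.refl
coeff-plusOne-suc (_ ∷ _) _ = ≡.refl

prime∧≢2⇒odd : ∀ {p} → Prime p → p ≢ 2 → ¬ 2 ∣ p
prime∧≢2⇒odd p-prime p≢2 2∣p with prime⇒irreducible p-prime 2∣p
... | inj₁ ()
... | inj₂ 2≡p = p≢2 (≡.sym 2≡p)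

module FieldTheory {c ℓ} (K : Field c ℓ) where

  open Field K
  open import Algebra.Properties.CommutativeSemiring.Exp commutativeSemiring
  open import Algebra.Properties.Semiring.Sum semiring
  module +ₚ = Algebra.Properties.CommutativeSemigroup +-commutativeSemigroup
  module *ₚ = Algebra.Properties.CommutativeSemigroup *-commutativeSemigroup
  open import Algebra.Properties.Ring ring using ([y-z]x≈yx-zx)
  open import Algebra.Properties.Group +-group using (∙-cancelˡ; ∙-cancelʳ; x≈y⇒x∙y⁻¹≈ε; x∙y⁻¹≈ε⇒x≈y)
  open import Algebra.Definitions.RawSemiring (Semiring.rawSemiring semiring) using (_×_)
  open import Relation.Binary.Reasoning.Setoid setoid

  ^≡pow : ∀ x n → x ^ n ≡ pow K x n
  ^≡pow x zero    = ≡.refl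
  ^≡pow x (suc n) = ≡.cong (x *_) (^≡pow x n)

  1^n≈1 : ∀ n → 1# ^ n ≈ 1#
  1^n≈1 zero    = refl
  1^n≈1 (suc n) = trans (*-identityˡ _) (1^n≈1 n)

  ^-multiple≈1 : ∀ x m {a} → x ^ m ≈ 1# → m ∣ a → x ^ a ≈ 1#
  ^-multiple≈1 x m xᵐ≈1 (divides q ≡.refl) = begin
    x ^ (q ℕ.* m)   ≡⟨ ≡.cong (x ^_) (ℕₚ.*-comm q m) ⟩
    x ^ (m ℕ.* q)   ≈⟨ ^-assocʳ x m q ⟨
    (x ^ m) ^ q     ≈⟨ ^-congˡ q xᵐ≈1 ⟩
    1# ^ q          ≈⟨ 1^n≈1 q ⟩
    1#              ∎

  x^a≈1⇒x^[1+a]≈x : ∀ {x a} → x ^ a ≈ 1# → x ^ suc a ≈ x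
  x^a≈1⇒x^[1+a]≈x {x} xᵃ≈1 = trans (*-congˡ xᵃ≈1) (*-identityʳ x)

  ^-swap : ∀ x m n → (x ^ m) ^ n ≈ (x ^ n) ^ m
  ^-swap x m n = begin
    (x ^ m) ^ n     ≈⟨ ^-assocʳ x m n ⟩
    x ^ (m ℕ.* n)   ≡⟨ ≡.cong (x ^_) (ℕₚ.*-comm m n) ⟩
    x ^ (n ℕ.* m)   ≈⟨ ^-assocʳ x n m ⟨
    (x ^ n) ^ m     ∎

  *≈0⇒≈0 : ∀ {x y} → x ≉ 0# → x * y ≈ 0# → y ≈ 0#
  *≈0⇒≈0 {x} {y} x≉0 xy≈0 with x⁻¹ , xx⁻¹≈1 ← inverse x x≉0 = begin
    y                ≈⟨ *-identityˡ y ⟨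
    1# * y           ≈⟨ *-congʳ xx⁻¹≈1 ⟨
    (x * x⁻¹) * y    ≈⟨ *-congʳ (*-comm x x⁻¹) ⟩
    (x⁻¹ * x) * y    ≈⟨ *-assoc x⁻¹ x y ⟩
    x⁻¹ * (x * y)    ≈⟨ *-congˡ xy≈0 ⟩
    x⁻¹ * 0#         ≈⟨ zeroʳ x⁻¹ ⟩
    0#               ∎

  sum-δ : ∀ {n} (t : Vector Carrier n) k → (∀ j → j ≢ k → t j ≈ 0#) → sum t ≈ t k
  sum-δ {suc n} t k others = begin
    sum t                                 ≈⟨ sum-remove {i = k} t ⟩
    t k + sum {n} (t ∘ Fin.punchIn k)      ≈⟨ +-congˡ (sum-cong-≋ λ j → others _ (Finₚ.punchInᵢ≢i k j)) ⟩
    t k + sum {n} (λ _ → 0#)              ≈⟨ +-congˡ (sum-replicate-zero n) ⟩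
    t k + 0#                              ≈⟨ +-identityʳ (t k) ⟩
    t k                                   ∎

  powerSum : Carrier → ℕ → Carrier
  powerSum y n = sum {n} (λ j → y ^ toℕ j)

  powerSum-geometric : ∀ y n → 1# + y * powerSum y n ≈ powerSum y n + y ^ n
  powerSum-geometric y zero = begin
    1# + y * 0#   ≈⟨ +-congˡ (zeroʳ y) ⟩
    1# + 0#       ≈⟨ +-comm 1# 0# ⟩
    0# + 1#       ∎
  powerSum-geometric y (suc n) = begin
    1# + y * S′              ≈⟨ +-congˡ (*-congˡ S′≈S+yⁿ) ⟩
    1# + y * (S + y ^ n)     ≈⟨ +-congˡ (distribˡ y S (y ^ n)) ⟩
    1# + (y * S + y ^ suc n) ≈⟨ +-assoc 1# (y * S) (y ^ suc n) ⟨
    (1# + y * S) + y ^ suc n ≈⟨ +-congʳ S′≈1+yS ⟨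
    S′ + y ^ suc n           ∎
    where
    S  = powerSum y n
    S′ = powerSum y (suc n)
    S′≈1+yS : S′ ≈ 1# + y * S
    S′≈1+yS = +-congˡ (sym (*-distribˡ-sum y (λ (j : Fin n) → y ^ toℕ j)))
    S′≈S+yⁿ : S′ ≈ S + y ^ n
    S′≈S+yⁿ = trans S′≈1+yS (powerSum-geometric y n)

  powerSum-root≈0 : ∀ {y} n → y ≉ 1# → y ^ n ≈ 1# → powerSum y n ≈ 0#
  powerSum-root≈0 {y} n y≉1 yⁿ≈1 = *≈0⇒≈0 y-1≉0 (begin
    (y - 1#) * S      ≈⟨ [y-z]x≈yx-zx S y 1# ⟩
    y * S - 1# * S    ≈⟨ x≈y⇒x∙y⁻¹≈ε (trans yS≈S (sym (*-identityˡ S))) ⟩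
    0#                ∎)
    where
    S = powerSum y n
    y-1≉0 : y - 1# ≉ 0#
    y-1≉0 = y≉1 ∘ x∙y⁻¹≈ε⇒x≈y y 1#
    yS≈S : y * S ≈ S
    yS≈S = ∙-cancelˡ 1# (y * S) S (begin
      1# + y * S     ≈⟨ powerSum-geometric y n ⟩
      S + y ^ n      ≈⟨ +-congˡ yⁿ≈1 ⟩
      S + 1#         ≈⟨ +-comm S 1# ⟩
      1# + S         ∎)

  fromBool : Bool → Carrier
  fromBool b = if b then 1# else 0#

  fromBool-injective : ∀ {a b} → fromBool a ≈ fromBool b → a ≡ b
  fromBool-injective {true}  {true}  _   = ≡.refl
  fromBool-injective {true}  {false} 1≈0 = contradiction 1≈0 1≉0
  fromBool-injective {false} {true}  0≈1 = contradiction (sym 0≈1) 1≉0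
  fromBool-injective {false} {false} _   = ≡.refl

  eval-cong : ∀ H {x y} → x ≈ y → eval K H x ≈ eval K H y
  eval-cong []       _   = refl
  eval-cong (_ ∷ bs) x≈y = +-congˡ (*-cong x≈y (eval-cong bs x≈y))

  eval-≈0 : ∀ H {x} → (∀ i → coeff H i ≡ false) → eval K H x ≈ 0#
  eval-≈0 []       _ = refl
  eval-≈0 (b ∷ bs) {x} z with ≡.refl ← z 0 = begin
    0# + x * eval K bs x   ≈⟨ +-identityˡ _ ⟩
    x * eval K bs x        ≈⟨ *-congˡ (eval-≈0 bs (z ∘ suc)) ⟩
    x * 0#                 ≈⟨ zeroʳ x ⟩
    0#                     ∎

  eval-≐ : ∀ F G {x} → F ≐ G → eval K F x ≈ eval K G x
  eval-≐ []       []       _   = refl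
  eval-≐ []       (b ∷ bs) F≐G = sym (eval-≈0 (b ∷ bs) (≡.sym ∘ F≐G))
  eval-≐ (a ∷ as) []       F≐G = eval-≈0 (a ∷ as) F≐G
  eval-≐ (a ∷ as) (b ∷ bs) F≐G with ≡.refl ← F≐G 0 = +-congˡ (*-congˡ (eval-≐ as bs (F≐G ∘ suc)))

  eval-sum : ∀ n H x → (∀ i → n ≤ i → coeff H i ≡ false) →
             eval K H x ≈ sum {n} (λ i → fromBool (coeff H (toℕ i)) * x ^ toℕ i)
  eval-sum zero    H        x vanish = eval-≈0 H (λ i → vanish i z≤n)
  eval-sum (suc n) []       x _      =
    sym (trans (sum-cong-≋ {suc n} (λ i → zeroˡ (x ^ toℕ i))) (sum-replicate-zero (suc n)))
  eval-sum (suc n) (b ∷ bs) x vanish = +-cong (sym (*-identityʳ _)) (begin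
    x * eval K bs x
      ≈⟨ *-congˡ (eval-sum n bs x (λ i → vanish (suc i) ∘ s≤s)) ⟩
    x * sum {n} (λ i → fromBool (coeff bs (toℕ i)) * x ^ toℕ i)
      ≈⟨ *-distribˡ-sum {n} x _ ⟩
    sum {n} (λ i → x * (fromBool (coeff bs (toℕ i)) * x ^ toℕ i))
      ≈⟨ sum-cong-≋ {n} (λ i → *ₚ.x∙yz≈y∙xz x _ _) ⟩
    sum {n} (λ i → fromBool (coeff bs (toℕ i)) * (x * x ^ toℕ i)) ∎)

  module RootOfUnity {m} (p-prime : Prime (suc (suc m)))
                     {θ} (θᵖ≈1 : θ ^ suc (suc m) ≈ 1#) (θ≉1 : θ ≉ 1#) where

    open import Data.Nat.DivMod using (_%_; m≡m%n+[m/n]*n; m%n<n)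
    open import Data.Nat.Coprimality using (prime⇒coprime; coprime-Bézout)
    open import Data.Nat.GCD using (module Bézout)

    private
      p : ℕ
      p = suc (suc m)

    ^-mod : ∀ a → θ ^ a ≈ θ ^ (a % p)
    ^-mod a = begin
      θ ^ a                                  ≡⟨ ≡.cong (θ ^_) (m≡m%n+[m/n]*n a p) ⟩
      θ ^ (a % p ℕ.+ (a ℕ./ p) ℕ.* p)        ≈⟨ ^-homo-* θ (a % p) _ ⟩
      θ ^ (a % p) * θ ^ ((a ℕ./ p) ℕ.* p)    ≈⟨ *-congˡ (^-multiple≈1 θ p θᵖ≈1 (divides (a ℕ./ p) ≡.refl)) ⟩
      θ ^ (a % p) * 1#                       ≈⟨ *-identityʳ _ ⟩
      θ ^ (a % p)                            ∎

    ^≉1 : ∀ {r} → 0 < r → r < p → θ ^ r ≉ 1#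
    ^≉1 {r} 0<r r<p θʳ≈1 with coprime-Bézout (prime⇒coprime p-prime {{>-nonZero 0<r}} r<p)
    ... | Bézout.+- x y 1+yr≡xp = θ≉1 (begin
      θ                   ≈⟨ x^a≈1⇒x^[1+a]≈x {a = y ℕ.* r} (^-multiple≈1 θ r θʳ≈1 (divides y ≡.refl)) ⟨
      θ ^ (1 ℕ.+ y ℕ.* r) ≡⟨ ≡.cong (θ ^_) 1+yr≡xp ⟩
      θ ^ (x ℕ.* p)       ≈⟨ ^-multiple≈1 θ p θᵖ≈1 (divides x ≡.refl) ⟩
      1#                  ∎)
    ... | Bézout.-+ x y 1+xp≡yr = θ≉1 (begin
      θ                   ≈⟨ x^a≈1⇒x^[1+a]≈x {a = x ℕ.* p} (^-multiple≈1 θ p θᵖ≈1 (divides x ≡.refl)) ⟨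
      θ ^ (1 ℕ.+ x ℕ.* p) ≡⟨ ≡.cong (θ ^_) 1+xp≡yr ⟩
      θ ^ (y ℕ.* r)       ≈⟨ ^-multiple≈1 θ r θʳ≈1 (divides y ≡.refl) ⟩
      1#                  ∎)

    ^≈1⇒∣ : ∀ {a} → θ ^ a ≈ 1# → p ∣ a
    ^≈1⇒∣ {a} θᵃ≈1 with a % p in a%p≡r
    ... | zero  = m%n≡0⇒n∣m a p a%p≡r
    ... | suc r = contradiction (trans (sym θᵃ≈θ^[1+r]) θᵃ≈1) (^≉1 (s≤s z≤n) 1+r<p)
      where
      θᵃ≈θ^[1+r] : θ ^ a ≈ θ ^ suc r
      θᵃ≈θ^[1+r] = trans (^-mod a) (reflexive (≡.cong (θ ^_) a%p≡r))
      1+r<p : suc r < p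
      1+r<p = ≡.subst (_< p) a%p≡r (m%n<n a p)

    powerSum-orthogonal : ∀ {i k} → i < p → k < p → i ≢ k → powerSum (θ ^ (i ℕ.+ (p ℕ.∸ k))) p ≈ 0#
    powerSum-orthogonal {i} {k} i<p k<p i≢k = powerSum-root≈0 p
      (i≢k ∘ ∣+∸⇒≡ i<p k<p ∘ ^≈1⇒∣)
      (trans (^-assocʳ θ e p) (^-multiple≈1 θ p θᵖ≈1 (divides e ≡.refl)))
      where e = i ℕ.+ (p ℕ.∸ k)

    powerSum-diagonal : ∀ {k} → k ≤ p → powerSum (θ ^ (k ℕ.+ (p ℕ.∸ k))) p ≈ p × 1#
    powerSum-diagonal {k} k≤p = begin
      powerSum (θ ^ (k ℕ.+ (p ℕ.∸ k))) p  ≈⟨ sum-cong-≋ {p} (λ j → ^-congˡ (toℕ j) θᵏ⁺⁽ᵖ⁻ᵏ⁾≈1) ⟩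
      powerSum 1# p                       ≈⟨ sum-cong-≋ {p} (λ j → 1^n≈1 (toℕ j)) ⟩
      sum {p} (λ _ → 1#)                  ≈⟨ sum-replicate p ⟩
      p × 1#                              ∎
      where
      θᵏ⁺⁽ᵖ⁻ᵏ⁾≈1 : θ ^ (k ℕ.+ (p ℕ.∸ k)) ≈ 1#
      θᵏ⁺⁽ᵖ⁻ᵏ⁾≈1 = trans (reflexive (≡.cong (θ ^_) (ℕₚ.m+[n∸m]≡n k≤p))) θᵖ≈1

    -- The weight θ ^ (p ∸ k) is θ⁻ᵏ.
    dft-inversion : ∀ H → (∀ i → p ≤ i → coeff H i ≡ false) → (k : Fin p) →
                    sum {p} (λ j → (θ ^ (p ℕ.∸ toℕ k)) ^ toℕ j * eval K H (θ ^ toℕ j))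
                      ≈ fromBool (coeff H (toℕ k)) * (p × 1#)
    dft-inversion H vanish k = begin
      sum {p} (λ j → u ^ toℕ j * eval K H (θ ^ toℕ j))
        ≈⟨ sum-cong-≋ {p} (λ j → *-congˡ {u ^ toℕ j} (eval-sum p H (θ ^ toℕ j) vanish)) ⟩
      sum {p} (λ j → u ^ toℕ j * sum {p} (λ i → h i * (θ ^ toℕ j) ^ toℕ i))
        ≈⟨ sum-cong-≋ {p} (λ j → trans (*-distribˡ-sum {p} (u ^ toℕ j) (λ i → h i * (θ ^ toℕ j) ^ toℕ i))
                                       (sum-cong-≋ {p} (λ i → regroup i j))) ⟩
      sum {p} (λ j → sum {p} (λ i → h i * (θ ^ (toℕ i ℕ.+ e)) ^ toℕ j))
        ≈⟨ ∑-comm {p} {p} (λ j i → h i * (θ ^ (toℕ i ℕ.+ e)) ^ toℕ j) ⟩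
      sum {p} (λ i → sum {p} (λ j → h i * (θ ^ (toℕ i ℕ.+ e)) ^ toℕ j))
        ≈⟨ sum-cong-≋ {p} (λ i → sym (*-distribˡ-sum {p} (h i) (λ j → (θ ^ (toℕ i ℕ.+ e)) ^ toℕ j))) ⟩
      sum {p} (λ i → h i * powerSum (θ ^ (toℕ i ℕ.+ e)) p)
        ≈⟨ sum-δ _ k (λ i i≢k → trans (*-congˡ (orthogonal i i≢k)) (zeroʳ (h i))) ⟩
      h k * powerSum (θ ^ (toℕ k ℕ.+ e)) p
        ≈⟨ *-congˡ (powerSum-diagonal (ℕₚ.<⇒≤ (Finₚ.toℕ<n k))) ⟩
      h k * (p × 1#)
        ∎
      where
      e = p ℕ.∸ toℕ k
      u = θ ^ e
      h : Fin p → Carrier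
      h i = fromBool (coeff H (toℕ i))
      orthogonal : ∀ i → i ≢ k → powerSum (θ ^ (toℕ i ℕ.+ e)) p ≈ 0#
      orthogonal i i≢k = powerSum-orthogonal (Finₚ.toℕ<n i) (Finₚ.toℕ<n k) (i≢k ∘ Finₚ.toℕ-injective)
      regroup : ∀ i j → u ^ toℕ j * (h i * (θ ^ toℕ j) ^ toℕ i) ≈ h i * (θ ^ (toℕ i ℕ.+ e)) ^ toℕ j
      regroup i j = trans (*ₚ.x∙yz≈y∙xz (u ^ toℕ j) (h i) ((θ ^ toℕ j) ^ toℕ i)) (*-congˡ (begin
        (θ ^ e) ^ toℕ j * (θ ^ toℕ j) ^ toℕ i    ≈⟨ *-comm _ _ ⟩
        (θ ^ toℕ j) ^ toℕ i * (θ ^ e) ^ toℕ j    ≈⟨ *-congʳ (^-swap θ (toℕ j) (toℕ i)) ⟩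
        (θ ^ toℕ i) ^ toℕ j * (θ ^ e) ^ toℕ j    ≈⟨ ^-distrib-* (θ ^ toℕ i) (θ ^ e) (toℕ j) ⟨
        (θ ^ toℕ i * θ ^ e) ^ toℕ j              ≈⟨ ^-congˡ (toℕ j) (^-homo-* θ (toℕ i) e) ⟨
        (θ ^ (toℕ i ℕ.+ e)) ^ toℕ j              ∎))

    dft-vanishing : ∀ H → (∀ i → p ≤ i → coeff H i ≡ false) →
                    (∀ j → 0 < j → j < p → eval K H (θ ^ j) ≈ 0#) →
                    (k : Fin p) → fromBool (coeff H (toℕ k)) * (p × 1#) ≈ eval K H 1#
    dft-vanishing H vanish roots k = begin
      fromBool (coeff H (toℕ k)) * (p × 1#)  ≈⟨ dft-inversion H vanish k ⟨
      sum {p} t                              ≈⟨ sum-δ t Fin.zero others ⟩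
      1# * eval K H 1#                       ≈⟨ *-identityˡ _ ⟩
      eval K H 1#                            ∎
      where
      t : Fin p → Carrier
      t j = (θ ^ (p ℕ.∸ toℕ k)) ^ toℕ j * eval K H (θ ^ toℕ j)
      others : ∀ j → j ≢ Fin.zero → t j ≈ 0#
      others Fin.zero    j≢0 = contradiction ≡.refl j≢0
      others (Fin.suc j) _   =
        trans (*-congˡ (roots (suc (toℕ j)) (s≤s z≤n) (s≤s (Finₚ.toℕ<n j)))) (zeroʳ _)

  module Char2 (char2 : HasChar2 K) where

    open import Algebra.Solver.Ring.NaturalCoefficients.Default commutativeSemiring

    x+x≈0 : ∀ x → x + x ≈ 0#
    x+x≈0 x = begin
      x + x              ≈⟨ +-cong (*-identityˡ x) (*-identityˡ x) ⟨
      1# * x + 1# * x    ≈⟨ distribʳ x 1# 1# ⟨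
      (1# + 1#) * x      ≈⟨ *-congʳ char2 ⟩
      0# * x             ≈⟨ zeroˡ x ⟩
      0#                 ∎

    +≈0⇒≈ : ∀ {x y} → x + y ≈ 0# → x ≈ y
    +≈0⇒≈ {x} {y} x+y≈0 = ∙-cancelʳ y x y (trans x+y≈0 (sym (x+x≈0 y)))

    ≈⇒+≈0 : ∀ {x y} → x ≈ y → x + y ≈ 0#
    ≈⇒+≈0 {x} {y} x≈y = trans (+-congʳ x≈y) (x+x≈0 y)

    ×1#-odd : ∀ n → ¬ 2 ∣ n → n × 1# ≈ 1#
    ×1#-odd zero          2∤0   = contradiction (divides 0 ≡.refl) 2∤0
    ×1#-odd (suc zero)    _     = +-identityʳ 1#
    ×1#-odd (suc (suc n)) 2∤2+n = begin
      1# + (1# + n × 1#)   ≈⟨ +-assoc 1# 1# (n × 1#) ⟨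
      (1# + 1#) + n × 1#   ≈⟨ +-congʳ char2 ⟩
      0# + n × 1#          ≈⟨ +-identityˡ (n × 1#) ⟩
      n × 1#               ≈⟨ ×1#-odd n (2∤2+n ∘ ∣m∣n⇒∣m+n ∣-refl) ⟩
      1#                   ∎

    fromBool-not : ∀ b → fromBool (not b) ≈ fromBool b + 1#
    fromBool-not true  = sym char2
    fromBool-not false = sym (+-identityˡ 1#)

    fromBool-idem : ∀ b → fromBool b * fromBool b ≈ fromBool b
    fromBool-idem true  = *-identityˡ 1#
    fromBool-idem false = zeroˡ 0#

    eval-plusOne : ∀ G x → eval K (plusOne G) x ≈ eval K G x + 1#
    eval-plusOne []       x = trans (+-congˡ (zeroʳ x)) (+-comm 1# 0#)
    eval-plusOne (b ∷ bs) x = begin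
      fromBool (not b) + x * eval K bs x      ≈⟨ +-congʳ (fromBool-not b) ⟩
      (fromBool b + 1#) + x * eval K bs x     ≈⟨ +ₚ.xy∙z≈xz∙y (fromBool b) 1# _ ⟩
      (fromBool b + x * eval K bs x) + 1#     ∎

    [x+y]²≈x²+y² : ∀ x y → (x + y) * (x + y) ≈ x * x + y * y
    [x+y]²≈x²+y² x y = begin
      (x + y) * (x + y)
        ≈⟨ solve 2 (λ x y → (x :+ y) :* (x :+ y) := (x :* x :+ y :* y) :+ (x :* y :+ x :* y)) refl x y ⟩
      (x * x + y * y) + (x * y + x * y)  ≈⟨ +-congˡ (x+x≈0 (x * y)) ⟩
      (x * x + y * y) + 0#               ≈⟨ +-identityʳ _ ⟩
      x * x + y * y                      ∎

    eval-square : ∀ H x → eval K H (x * x) ≈ eval K H x * eval K H x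
    eval-square []       x = sym (zeroˡ 0#)
    eval-square (b ∷ bs) x = begin
      fromBool b + (x * x) * eval K bs (x * x)   ≈⟨ +-cong (fromBool-idem b) (*-congˡ (sym (eval-square bs x))) ⟨
      β * β + (x * x) * (e * e)                  ≈⟨ +-congˡ (*ₚ.interchange x x e e) ⟩
      β * β + (x * e) * (x * e)                  ≈⟨ [x+y]²≈x²+y² β (x * e) ⟨
      (β + x * e) * (β + x * e)                  ∎
      where
      β = fromBool b
      e = eval K bs x

    eval-^2^ : ∀ H {x} → eval K H x ≈ 0# → ∀ k → eval K H (x ^ (2 ℕ.^ k)) ≈ 0#
    eval-^2^ H {x} Hx≈0 zero    = trans (eval-cong H (*-identityʳ x)) Hx≈0
    eval-^2^ H {x} Hx≈0 (suc k) = begin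
      eval K H (x ^ (a ℕ.+ (a ℕ.+ 0)))    ≈⟨ eval-cong H (^-homo-* x a (a ℕ.+ 0)) ⟩
      eval K H (x ^ a * x ^ (a ℕ.+ 0))    ≡⟨ ≡.cong (λ b → eval K H (x ^ a * x ^ b)) (ℕₚ.+-identityʳ a) ⟩
      eval K H (x ^ a * x ^ a)            ≈⟨ eval-square H (x ^ a) ⟩
      eval K H (x ^ a) * eval K H (x ^ a) ≈⟨ *-congʳ (eval-^2^ H Hx≈0 k) ⟩
      0# * eval K H (x ^ a)               ≈⟨ zeroˡ _ ⟩
      0#                                  ∎
      where a = 2 ℕ.^ k

  module Char2RootOfUnity (char2 : HasChar2 K) {m} (p-prime : Prime (suc (suc m)))
                          {θ} (θᵖ≈1 : θ ^ suc (suc m) ≈ 1#) (θ≉1 : θ ≉ 1#) where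

    open Char2 char2
    open RootOfUnity p-prime θᵖ≈1 θ≉1

    private
      p : ℕ
      p = suc (suc m)

    conjugate-roots : IsPrimitiveRootMod 2 p → ∀ H → eval K H θ ≈ 0# →
                      ∀ j → 0 < j → j < p → eval K H (θ ^ j) ≈ 0#
    conjugate-roots prim H Hθ≈0 j 0<j j<p
      with k , 2ᵏ%p≡j ← PrimitiveRoot.powMod-surjective prim j 0<j j<p = begin
      eval K H (θ ^ j)                   ≡⟨ ≡.cong (λ a → eval K H (θ ^ a)) 2ᵏ%p≡j ⟨
      eval K H (θ ^ (2 ℕ.^ k ℕ.% p))     ≈⟨ eval-cong H (^-mod (2 ℕ.^ k)) ⟨
      eval K H (θ ^ (2 ℕ.^ k))           ≈⟨ eval-^2^ H Hθ≈0 k ⟩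
      0#                                 ∎

    coeff-constant : ¬ 2 ∣ p → ∀ H → (∀ i → p ≤ i → coeff H i ≡ false) →
                     (∀ j → 0 < j → j < p → eval K H (θ ^ j) ≈ 0#) →
                     ∀ i → i < p → coeff H i ≡ coeff H 0
    coeff-constant 2∤p H vanish roots i i<p = ≡.trans (≡.cong (coeff H) (≡.sym (Finₚ.toℕ-fromℕ< i<p)))
      (fromBool-injective (trans (coeff≈eval-at-1 (fromℕ< i<p)) (sym (coeff≈eval-at-1 Fin.zero))))
      where
      coeff≈eval-at-1 : ∀ k → fromBool (coeff H (toℕ k)) ≈ eval K H 1#
      coeff≈eval-at-1 k = begin
        fromBool (coeff H (toℕ k))             ≈⟨ *-identityʳ _ ⟨
        fromBool (coeff H (toℕ k)) * 1#        ≈⟨ *-congˡ (×1#-odd p 2∤p) ⟨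
        fromBool (coeff H (toℕ k)) * (p × 1#)  ≈⟨ dft-vanishing H vanish roots k ⟩
        eval K H 1#                            ∎

    eval-sumX : eval K (sumX p) θ ≈ 1#
    eval-sumX = sym (+≈0⇒≈ (begin
      1# + eval K (sumX p) θ
        ≈⟨ +-congˡ (eval-sum p (sumX p) θ beyond) ⟩
      1# + (0# * 1# + sum {suc m} (λ i → fromBool (coeff (sumX p) (suc (toℕ i))) * θ ^ suc (toℕ i)))
        ≈⟨ +-congˡ (trans (+-congʳ (zeroˡ 1#)) (trans (+-identityˡ _) (sum-cong-≋ {suc m} ones))) ⟩
      powerSum θ p
        ≈⟨ powerSum-root≈0 p θ≉1 θᵖ≈1 ⟩
      0#  ∎))
      where
      beyond : ∀ i → p ≤ i → coeff (sumX p) i ≡ false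
      beyond (suc i) (s≤s p≤1+i) = coeff-sumX-≥ (suc m) i p≤1+i
      ones : ∀ i → fromBool (coeff (sumX p) (suc (toℕ i))) * θ ^ suc (toℕ i) ≈ θ ^ suc (toℕ i)
      ones i = trans (reflexive (≡.cong (λ b → fromBool b * θ ^ suc (toℕ i))
                                        (coeff-sumX-< (suc m) (toℕ i) (Finₚ.toℕ<n i))))
                     (*-identityˡ _)

lemma4 : ∀ {c ℓ} (p : ℕ) .{{_ : NonZero p}} → Prime p → ¬ (p ≡ 2) → IsPrimitiveRootMod 2 p →
         (K : Field c ℓ) → HasChar2 K →
         (θ : Field.Carrier K) → Field._≈_ K (pow K θ p) (Field.1# K) → ¬ (Field._≈_ K θ (Field.1# K)) →
         (G : Poly₂) → 1 ≤ deg G → deg G < p →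
         (Field._≈_ K (eval K G θ) (Field.1# K) ⇔ (G ≐ sumX p))
lemma4 zero          p-prime = contradiction p-prime ¬prime[0]
lemma4 (suc zero)    p-prime = contradiction p-prime ¬prime[1]
lemma4 p@(suc (suc m)) p-prime p≢2 prim K char2 θ θᵖ≈1 θ≉1 G 1≤deg deg<p = mk⇔ forward backward
  where
  open Field K using (_≈_; 0#; 1#; trans; reflexive)
  open FieldTheory K
  open Char2 char2
  open Char2RootOfUnity char2 p-prime (trans (reflexive (^≡pow θ p)) θᵖ≈1) θ≉1
  H : Poly₂
  H = plusOne G
  H-vanish : ∀ i → p ≤ i → coeff H i ≡ false
  H-vanish (suc i) p≤1+i =
    ≡.trans (coeff-plusOne-suc G i) (deg<⇒coeff≡false G (suc i) (ℕₚ.<-≤-trans deg<p p≤1+i))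
  forward : eval K G θ ≈ 1# → G ≐ sumX p
  forward Gθ≈1 = flat⇒≐sumX (suc m) G 1≤deg (ℕₚ.≤-pred deg<p) λ i i<1+m → begin
    coeff G (suc i)    ≡⟨ coeff-plusOne-suc G i ⟨
    coeff H (suc i)    ≡⟨ coeff-constant (prime∧≢2⇒odd p-prime p≢2) H H-vanish
                            (conjugate-roots prim H Hθ≈0) (suc i) (s≤s i<1+m) ⟩
    coeff H 0          ≡⟨ coeff-plusOne-zero G ⟩
    not (coeff G 0)    ∎
    where
    open ≡.≡-Reasoning
    Hθ≈0 : eval K H θ ≈ 0#
    Hθ≈0 = trans (eval-plusOne G θ) (≈⇒+≈0 Gθ≈1)
  backward : G ≐ sumX p → eval K G θ ≈ 1#
  backward G≐sumX = trans (eval-≐ G (sumX p) G≐sumX) eval-sumX
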